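{- Let $G$ and $H$ be finite simple graphs without isolated vertices. Let $D_G\subseteq V(G)$ and $D_H\subseteq V(H)$ be canonical dominating sets of $G$ and $H$ respectively with $|D_G|=\gamma(G)$ and $|D_H|=\gamma(H)$. Let $F_G:V(G)\setminus D_G\to D_G$ and $F_H:V(H)\setminus D_H\to D_H$ be surjective functions such that $F_G(u)=u'$ implies $u\sim u'$ in $G$, and $F_H(v)=v'$ implies $v\sim v'$ in $H$. Define $S:V(G\mathbin{\square}H)\setminus (D_G\times D_H)\to D_G\times D_H$ by $$S(u,v)=\begin{cases}(F_G(u),v) & \text{if } u\in V(G)\setminus D_G,\ v\in D_H,\\ (u,F_H(v)) & \text{if } u\in D_G,\ v\in V(H)\setminus D_H,\\ (F_G(u),F_H(v)) & \text{if } u\in V(G)\setminus D_G,\ v\in V(H)\setminus D_H,\end{cases}$$ let $$E_S=\big\{\{(u,v),(u',v')\} : (u,v)\in (V(G)\setminus D_G)\times (V(H)\setminus D_H),\ S(u,v)=(u',v')\big\},$$ and let $A_{G,H}[F_G,F_H]$ be the graph with vertex set $V(G\mathbin{\square}H)=V(G)\times V(H)$ and edge set $E(G\mathbin{\square}H)\cup E_S$. Then $D_G\times D_H$ is a minimal dominating set of $A_{G,H}[F_G,F_H]$.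
   Context: A set $D\subseteq V(X)$ dominates a graph $X$ if every $v\in V(X)\setminus D$ is adjacent to some $u\in D$; $\gamma(X)$ is the minimum size of a dominating set of $X$. A dominating set is minimal if no proper subset of it is dominating. For a dominating set $D$ and $u\in D$, a vertex $v\in V(X)\setminus D$ is a private neighbor of $u$ if $u\sim v$ and $N(v)\cap D=\{u\}$, where $N(v)$ is the open neighborhood of $v$. A dominating set $D$ is canonical if every $u\in D$ has at least one private neighbor. The Cartesian product $G\mathbin{\square}H$ has vertex set $V(G)\times V(H)$, with $(u,v)\sim(u',v')$ iff either $u=u'$ and $v\sim v'$ in $H$, or $v=v'$ and $u\sim u'$ in $G$. -}

module Defs where

open import Data.Nat using (ℕ; _≤_)
open import Data.Bool using (Bool; true; false)
open import Data.Fin using (Fin)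
open import Data.Fin.Subset using (Subset; _∈_; _∉_; ∣_∣)
open import Data.Fin.Subset.Properties using (_∈?_)
open import Data.Product using (Σ; ∃; _×_; _,_)
open import Data.Sum using (_⊎_)
open import Relation.Nullary using (¬_; yes; no)
open import Relation.Binary.PropositionalEquality using (_≡_)

record Graph : Set where
  field
    n      : ℕ
    adj    : Fin n → Fin n → Bool
    sym    : ∀ u v → adj u v ≡ adj v u
    irrefl : ∀ v → adj v v ≡ false

  V : Set
  V = Fin n

  _∼_ : V → V → Set
  u ∼ v = adj u v ≡ true

open Graph public

module _ {V : Set} (_∼_ : V → V → Set) where

  Dominating : (V → Set) → Set
  Dominating D = ∀ v → ¬ D v → ∃ λ u → D u × u ∼ v

  MinimalDominating : (V → Set) → Set₁
  MinimalDominating D =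
    Dominating D ×
    (∀ (D′ : V → Set) → (∀ x → D′ x → D x) → (∃ λ x → D x × ¬ D′ x) →
       ¬ Dominating D′)

  PrivateNeighbor : (V → Set) → V → V → Set
  PrivateNeighbor D u v =
    ¬ D v × u ∼ v × (∀ w → D w → w ∼ v → w ≡ u)

  Canonical : (V → Set) → Set
  Canonical D = Dominating D × (∀ u → D u → ∃ λ v → PrivateNeighbor D u v)

⟦_⟧ : ∀ {k} → Subset k → Fin k → Set
⟦ D ⟧ v = v ∈ D

NoIsolated : Graph → Set
NoIsolated G = ∀ (v : V G) → ∃ λ u → _∼_ G u v

MinimumDominating : (G : Graph) → Subset (n G) → Set
MinimumDominating G D =
  Dominating (_∼_ G) ⟦ D ⟧ ×
  (∀ (D′ : Subset (n G)) → Dominating (_∼_ G) ⟦ D′ ⟧ → ∣ D ∣ ≤ ∣ D′ ∣)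

-- F : V(G) ∖ D → D, surjective, with F(u) ∼ u.  F is given as a total
-- function on V(G); only its values on V(G) ∖ D are constrained/used.
GoodMap : (G : Graph) → Subset (n G) → (V G → V G) → Set
GoodMap G D F =
  (∀ u → u ∉ D → F u ∈ D) ×
  (∀ u → u ∉ D → _∼_ G u (F u)) ×
  (∀ u′ → u′ ∈ D → ∃ λ u → u ∉ D × F u ≡ u′)

_□∼_ : {G H : Graph} → (V G × V H) → (V G × V H) → Set
_□∼_ {G} {H} (u , v) (u′ , v′) =
  (u ≡ u′ × _∼_ H v v′) ⊎ (v ≡ v′ × _∼_ G u u′)

module _ (G H : Graph) (DG : Subset (n G)) (DH : Subset (n H))
         (FG : V G → V G) (FH : V H → V H) where

  -- S on V(G□H) ∖ (DG × DH); on DG × DH (outside its domain) it is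
  -- given the irrelevant value (u , v).
  S : V G × V H → V G × V H
  S (u , v) with u ∈? DG | v ∈? DH
  ... | no _  | yes _ = (FG u , v)
  ... | yes _ | no _  = (u , FH v)
  ... | no _  | no _  = (FG u , FH v)
  ... | yes _ | yes _ = (u , v)

  -- ordered version of E_S: x ∈ (V(G)∖DG) × (V(H)∖DH) and S x = y
  ES : V G × V H → V G × V H → Set
  ES (u , v) y = (u ∉ DG × v ∉ DH) × S (u , v) ≡ y

  A∼ : V G × V H → V G × V H → Set
  A∼ x y = _□∼_ {G} {H} x y ⊎ (ES x y ⊎ ES y x)

_⊠_ : {G H : Graph} → Subset (n G) → Subset (n H) → (V G × V H) → Set
(DG ⊠ DH) (u , v) = u ∈ DG × v ∈ DH

-- Every vertex (a , b) of D_G × D_H has a private neighbour in A_{G,H}: take a private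
-- neighbour a′ of a in G; then (a′ , b) is not an endpoint of any E_S edge (b ∈ D_H), so
-- its only neighbour in D_G × D_H is (a , b).  A dominating set all of whose members have
-- private neighbours is minimal.
module Submission where

open import Defs
open import Data.Fin.Subset using (Subset; _∈_)
open import Data.Fin.Subset.Properties using (_∈?_)
open import Data.Product using (∃; _×_; _,_; proj₁)
open import Data.Sum using (inj₁; inj₂)
open import Relation.Nullary using (¬_; yes; no; contradiction)
open import Relation.Binary.PropositionalEquality using (_≡_; refl; trans; subst; cong₂)

∼-sym : (G : Graph) → ∀ {u v} → _∼_ G u v → _∼_ G v u
∼-sym G {u} {v} = trans (Graph.sym G v u)

module _ {V : Set} {_∼_ : V → V → Set} {D : V → Set} where

  canonical⇒minimalDominating : Canonical _∼_ D → MinimalDominating _∼_ D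
  canonical⇒minimalDominating (dom , hasPrivate) = dom , minimal
    where
    minimal : ∀ D′ → (∀ x → D′ x → D x) → (∃ λ x → D x × ¬ D′ x) → ¬ Dominating _∼_ D′
    minimal D′ D′⊆D (x , x∈D , x∉D′) dom′ with hasPrivate x x∈D
    ... | v , v∉D , _ , unique with dom′ v (λ v∈D′ → v∉D (D′⊆D v v∈D′))
    ... | u , u∈D′ , u∼v = x∉D′ (subst D′ (unique u (D′⊆D u u∈D′) u∼v) u∈D′)

module _ (G H : Graph) (DG : Subset (n G)) (DH : Subset (n H))
         (FG : V G → V G) (FH : V H → V H) where

  private
    _≈_ : V G × V H → V G × V H → Set
    _≈_ = A∼ G H DG DH FG FH

  ⊠-dominating : GoodMap G DG FG → GoodMap H DH FH →
                 Dominating _≈_ (_⊠_ {G} {H} DG DH)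
  ⊠-dominating (FG∈DG , ∼FG , _) (FH∈DH , ∼FH , _) (u , v) uv∉D with u ∈? DG | v ∈? DH
  ... | yes u∈DG | yes v∈DH = contradiction (u∈DG , v∈DH) uv∉D
  ... | no u∉DG  | yes v∈DH =
    (FG u , v) , (FG∈DG u u∉DG , v∈DH) , inj₁ (inj₂ (refl , ∼-sym G (∼FG u u∉DG)))
  ... | yes u∈DG | no v∉DH  =
    (u , FH v) , (u∈DG , FH∈DH v v∉DH) , inj₁ (inj₁ (refl , ∼-sym H (∼FH v v∉DH)))
  ... | no u∉DG  | no v∉DH  =
    (FG u , FH v) , (FG∈DG u u∉DG , FH∈DH v v∉DH) , inj₂ (inj₂ ((u∉DG , v∉DH) , refl))

  ⊠-privateNeighbor : ∀ {a a′ b} → PrivateNeighbor (_∼_ G) ⟦ DG ⟧ a a′ → b ∈ DH →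
                      PrivateNeighbor _≈_ (_⊠_ {G} {H} DG DH) (a , b) (a′ , b)
  ⊠-privateNeighbor {a} {a′} {b} (a′∉DG , a∼a′ , unique) b∈DH =
    (λ a′b∈D → a′∉DG (proj₁ a′b∈D)) , inj₁ (inj₂ (refl , a∼a′)) , onlyNeighbor
    where
    onlyNeighbor : ∀ w → (_⊠_ {G} {H} DG DH) w → w ≈ (a′ , b) → w ≡ (a , b)
    onlyNeighbor (w₁ , w₂) (w₁∈DG , _) (inj₁ (inj₁ (w₁≡a′ , _))) =
      contradiction (subst (_∈ DG) w₁≡a′ w₁∈DG) a′∉DG
    onlyNeighbor (w₁ , w₂) (w₁∈DG , _) (inj₁ (inj₂ (w₂≡b , w₁∼a′))) =
      cong₂ _,_ (unique w₁ w₁∈DG w₁∼a′) w₂≡b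
    onlyNeighbor _ (w₁∈DG , _) (inj₂ (inj₁ ((w₁∉DG , _) , _))) = contradiction w₁∈DG w₁∉DG
    onlyNeighbor _ _ (inj₂ (inj₂ ((_ , b∉DH) , _))) = contradiction b∈DH b∉DH

  ⊠-canonical : Canonical (_∼_ G) ⟦ DG ⟧ → GoodMap G DG FG → GoodMap H DH FH →
                Canonical _≈_ (_⊠_ {G} {H} DG DH)
  ⊠-canonical (_ , privateG) goodG goodH =
    ⊠-dominating goodG goodH , λ { (a , b) (a∈DG , b∈DH) →
      let a′ , a′private = privateG a a∈DG
      in (a′ , b) , ⊠-privateNeighbor a′private b∈DH }

lemma3 : (G H : Graph) → NoIsolated G → NoIsolated H →
         (DG : Subset (n G)) (DH : Subset (n H)) →
         Canonical (_∼_ G) ⟦ DG ⟧ → Canonical (_∼_ H) ⟦ DH ⟧ →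
         MinimumDominating G DG → MinimumDominating H DH →
         (FG : V G → V G) (FH : V H → V H) →
         GoodMap G DG FG → GoodMap H DH FH →
         MinimalDominating (A∼ G H DG DH FG FH) (_⊠_ {G} {H} DG DH)
lemma3 G H _ _ DG DH canonicalG _ _ _ FG FH goodG goodH =
  canonical⇒minimalDominating (⊠-canonical G H DG DH FG FH canonicalG goodG goodH)
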